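{- Let $G$ be a finite group. If the cyclic subgroup graph $C(G)$ is Hamiltonian, then the power graph $\mathfrak{g}(G)$ is Hamiltonian.
   Context: The power graph $\mathfrak{g}(G)$ has vertex set $G$, distinct $x,y$ adjacent iff $\langle x\rangle\le\langle y\rangle$ or $\langle y\rangle\le\langle x\rangle$. Define $x\sim y$ iff $\langle x\rangle=\langle y\rangle$, with classes $[x]_\sim$. The cyclic subgroup graph $C(G)$ is the undirected graph with vertex set $G/\!\sim$, where distinct classes $A,B$ are adjacent iff there exist $a\in A$, $b\in B$ with $\langle b\rangle<\langle a\rangle$ or $\langle a\rangle<\langle b\rangle$. A graph is Hamiltonian if it has a cycle through every vertex exactly once. -}

module Defs where

open import Data.Nat using (ℕ; zero; suc; _≤_)
open import Data.Integer using (ℤ; +_; -[1+_])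
open import Data.Fin using (Fin; zero; suc; inject₁; fromℕ)
open import Data.Product using (Σ; ∃; _×_; _,_)
open import Data.Sum using (_⊎_)
open import Relation.Nullary using (¬_)
open import Relation.Binary.PropositionalEquality using (_≡_; _≢_)
open import Algebra.Structures using (IsGroup)

-- A finite group of order n, presented (up to isomorphism) on the carrier Fin n.
record FiniteGroup : Set where
  field
    n       : ℕ
    _∙_     : Fin n → Fin n → Fin n
    ε       : Fin n
    _⁻¹     : Fin n → Fin n
    isGroup : IsGroup _≡_ _∙_ ε _⁻¹

module _ (G : FiniteGroup) where
  open FiniteGroup G

  Elt : Set
  Elt = Fin n

  pow : Elt → ℕ → Elt
  pow x zero    = ε
  pow x (suc k) = x ∙ pow x k

  zpow : Elt → ℤ → Elt
  zpow x (+ k)      = pow x k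
  zpow x -[1+ k ]   = pow (x ⁻¹) (suc k)

  InCyc : Elt → Elt → Set
  InCyc z x = ∃ λ (k : ℤ) → z ≡ zpow x k

  CycLe : Elt → Elt → Set
  CycLe x y = ∀ z → InCyc z x → InCyc z y

  CycLt : Elt → Elt → Set
  CycLt x y = CycLe x y × ¬ CycLe y x

  _∼_ : Elt → Elt → Set
  x ∼ y = CycLe x y × CycLe y x

  PowAdj : Elt → Elt → Set
  PowAdj x y = x ≢ y × (CycLe x y ⊎ CycLe y x)

  CAdj : Elt → Elt → Set
  CAdj x y = ¬ (x ∼ y) ×
    (∃ λ a → ∃ λ b → a ∼ x × b ∼ y × (CycLt b a ⊎ CycLt a b))

-- Hamiltonian graph whose vertices are the classes of an equivalence _≈_ on V
-- (vertices represented by representatives) with adjacency Adj: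
-- a cycle v₀ v₁ … v_k v₀ (k+1 ≥ 3 vertices) visiting every vertex exactly once.
Hamiltonian : (V : Set) → (V → V → Set) → (V → V → Set) → Set
Hamiltonian V _≈_ Adj =
  ∃ λ (k : ℕ) → 2 ≤ k × Σ (Fin (suc k) → V) λ v →
      (∀ x → ∃ λ i → x ≈ v i)
    × (∀ i j → v i ≈ v j → i ≡ j)
    × (∀ (i : Fin k) → Adj (v (inject₁ i)) (v (suc i)))
    × Adj (v (fromℕ k)) (v zero)

PowerGraphHamiltonian : FiniteGroup → Set
PowerGraphHamiltonian G = Hamiltonian (Elt G) _≡_ (PowAdj G)

CyclicSubgroupGraphHamiltonian : FiniteGroup → Set
CyclicSubgroupGraphHamiltonian G = Hamiltonian (Elt G) (_∼_ G) (CAdj G)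

-- Order the elements of G by the position of their ∼-class on the Hamiltonian cycle of C(G):
-- first the class v₀, then v₁, …, finally v_k. Two distinct elements of one class generate the
-- same cyclic subgroup, so they are adjacent in 𝔤(G); and if two classes are adjacent in C(G),
-- then every element of one is adjacent in 𝔤(G) to every element of the other, because ⊂ between
-- cyclic subgroups only depends on the classes. Hence this ordering of G, closed up from the last
-- element of v_k to the first element of v₀, is a Hamiltonian cycle of 𝔤(G).
module Submission where

open import Defs
open import Data.Nat using (ℕ; zero; suc; pred; _+_; _≤_; _<_; _≟_; z≤n; s≤s)
open import Data.Nat.Properties
  using (≤-refl; ≤-trans; ≤-reflexive; n<1+n; <⇒≢; +-comm; +-mono-≤; <⇒≤; m<n⇒m<1+n; m<1+n⇒m<n∨m≡n; module ≤-Reasoning)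
open import Data.Fin using (Fin; zero; suc; inject₁; fromℕ; fromℕ<; toℕ)
open import Data.Fin.Properties using (toℕ-injective; toℕ-fromℕ; toℕ-fromℕ<; toℕ-inject₁; toℕ<n)
open import Data.Product using (∃; _×_; _,_; proj₁; proj₂)
open import Data.Sum using (_⊎_; inj₁; inj₂)
open import Data.Empty using (⊥-elim)
open import Function using (_∘_)
open import Data.Maybe using (just)
open import Data.Maybe.Relation.Binary.Connected using (Connected; just; just-nothing; nothing-just; nothing; drop-just)
open import Relation.Binary.PropositionalEquality using (_≡_; _≢_; refl; sym; trans; cong; subst; subst₂)
open import Data.List using (List; []; _∷_; _++_; filter; allFin; length; lookup; head; last)
open import Data.List.Properties using (length-++)
open import Data.List.Relation.Unary.All as All using (All; []; _∷_)
open import Data.List.Relation.Unary.All.Properties using (all-filter)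
open import Data.List.Relation.Unary.Any as Any using (here; there)
open import Data.List.Relation.Unary.Any.Properties using (lookup-index)
open import Data.List.Relation.Unary.AllPairs using ([]; _∷_)
open import Data.List.Relation.Unary.Linked using (Linked; []; [-]; _∷_)
open import Data.List.Relation.Unary.Linked.Properties using (++⁺)
open import Data.List.Relation.Unary.Unique.Propositional using (Unique)
import Data.List.Relation.Unary.Unique.Propositional.Properties as Unique
open import Data.List.Membership.Propositional using (_∈_)
open import Data.List.Membership.Propositional.Properties
  using (∈-filter⁺; ∈-++⁺ˡ; ∈-++⁺ʳ; ∈-++⁻; ∈-allFin; ∈-lookup; ∈-length)

module _ {A : Set} where

  ∈⇒≢[] : ∀ {x : A} {xs} → x ∈ xs → xs ≢ []
  ∈⇒≢[] (here _)  ()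
  ∈⇒≢[] (there _) ()

  head-++ : ∀ {xs ys : List A} → xs ≢ [] → head (xs ++ ys) ≡ head xs
  head-++ {[]}    xs≢[] = ⊥-elim (xs≢[] refl)
  head-++ {_ ∷ _} _     = refl

  last-++ : ∀ (xs : List A) {ys} → ys ≢ [] → last (xs ++ ys) ≡ last ys
  last-++ []           _             = refl
  last-++ (_ ∷ [])     {[]}    ys≢[] = ⊥-elim (ys≢[] refl)
  last-++ (_ ∷ [])     {_ ∷ _} _     = refl
  last-++ (_ ∷ y ∷ xs) ys≢[]         = last-++ (y ∷ xs) ys≢[]

  last-lookup : ∀ (x : A) xs → last (x ∷ xs) ≡ just (lookup (x ∷ xs) (fromℕ (length xs)))
  last-lookup x []       = refl
  last-lookup x (y ∷ xs) = last-lookup y xs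

  lookup-injective : ∀ {xs : List A} → Unique xs → ∀ i j → lookup xs i ≡ lookup xs j → i ≡ j
  lookup-injective {_ ∷ _} _            zero    zero    _ = refl
  lookup-injective {_ ∷ _} (x∉xs ∷ _)   zero    (suc j) e = ⊥-elim (All.lookup x∉xs (∈-lookup j) e)
  lookup-injective {_ ∷ _} (x∉xs ∷ _)   (suc i) zero    e = ⊥-elim (All.lookup x∉xs (∈-lookup i) (sym e))
  lookup-injective {_ ∷ _} (_ ∷ unique) (suc i) (suc j) e = cong suc (lookup-injective unique i j e)

  module _ {R : A → A → Set} where

    Linked-consecutive : ∀ {x xs} → Linked R (x ∷ xs) →
                         ∀ (i : Fin (length xs)) → R (lookup (x ∷ xs) (inject₁ i)) (lookup (x ∷ xs) (suc i))
    Linked-consecutive (r ∷ _)      zero    = r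
    Linked-consecutive (_ ∷ linked) (suc i) = Linked-consecutive linked i

    Linked-clique : ∀ {P : A → Set} {xs} → Unique xs → All P xs →
                    (∀ {x y} → x ≢ y → P x → P y → R x y) → Linked R xs
    Linked-clique []                   []             _    = []
    Linked-clique ([] ∷ [])            (_ ∷ [])       _    = [-]
    Linked-clique ((x≢y ∷ _) ∷ unique) (px ∷ py ∷ ps) edge =
      edge x≢y px py ∷ Linked-clique unique (py ∷ ps) edge

    All⇒Connected : ∀ {P Q : A → Set} {xs ys} → All P xs → All Q ys →
                    (∀ {x y} → P x → Q y → R x y) → Connected R (last xs) (head ys)
    All⇒Connected {xs = []}          {[]}    _          _        _    = nothing
    All⇒Connected {xs = []}          {_ ∷ _} _          _        _    = nothing-just
    All⇒Connected {xs = _ ∷ []}      {[]}    _          _        _    = just-nothing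
    All⇒Connected {xs = _ ∷ []}      {_ ∷ _} (px ∷ [])  (qy ∷ _) edge = just (edge px qy)
    All⇒Connected {xs = _ ∷ _ ∷ _}   {ys}    (_ ∷ pxs)  qys      edge = All⇒Connected pxs qys edge

    hamiltonian-fromList : (L : List A) → Unique L → (∀ x → x ∈ L) → 3 ≤ length L →
                           Linked R L → Connected R (last L) (head L) → Hamiltonian A _≡_ R
    hamiltonian-fromList (x ∷ xs) unique complete (s≤s 2≤length) linked closing =
      length xs , 2≤length , lookup (x ∷ xs) ,
      (λ y → Any.index (complete y) , lookup-index (complete y)) ,
      lookup-injective unique ,
      Linked-consecutive linked ,
      drop-just (subst (λ l → Connected R l (just x)) (last-lookup x xs) closing)

module Layers {A : Set} (xs : List A) (level : A → ℕ) where

  layer : ℕ → List A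
  layer j = filter (λ x → level x ≟ j) xs

  layersBelow : ℕ → List A
  layersBelow zero    = []
  layersBelow (suc j) = layersBelow j ++ layer j

  layer-level : ∀ j → All (λ x → level x ≡ j) (layer j)
  layer-level j = all-filter (λ x → level x ≟ j) xs

  ∈-layer⁺ : ∀ {x j} → x ∈ xs → level x ≡ j → x ∈ layer j
  ∈-layer⁺ {j = j} = ∈-filter⁺ (λ x → level x ≟ j)

  ∈-layersBelow⁻ : ∀ j {x} → x ∈ layersBelow j → level x < j
  ∈-layersBelow⁻ (suc j) x∈ with ∈-++⁻ (layersBelow j) x∈
  ... | inj₁ x∈below = m<n⇒m<1+n (∈-layersBelow⁻ j x∈below)
  ... | inj₂ x∈layer = ≤-reflexive (cong suc (All.lookup (layer-level j) x∈layer))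

  ∈-layersBelow⁺ : ∀ j {x} → x ∈ xs → level x < j → x ∈ layersBelow j
  ∈-layersBelow⁺ (suc j) x∈ x<1+j with m<1+n⇒m<n∨m≡n x<1+j
  ... | inj₁ x<j = ∈-++⁺ˡ (∈-layersBelow⁺ j x∈ x<j)
  ... | inj₂ x≡j = ∈-++⁺ʳ (layersBelow j) (∈-layer⁺ x∈ x≡j)

  layersBelow-unique : Unique xs → ∀ j → Unique (layersBelow j)
  layersBelow-unique unique zero    = []
  layersBelow-unique unique (suc j) =
    Unique.++⁺ (layersBelow-unique unique j) (Unique.filter⁺ (λ x → level x ≟ j) unique)
      (λ (x∈below , x∈layer) → <⇒≢ (∈-layersBelow⁻ j x∈below) (All.lookup (layer-level j) x∈layer))

  layer-linked : ∀ {R : A → A → Set} → Unique xs →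
                 (∀ {x y} → x ≢ y → level x ≡ level y → R x y) → ∀ j → Linked R (layer j)
  layer-linked unique same j =
    Linked-clique (Unique.filter⁺ (λ x → level x ≟ j) unique) (layer-level j)
      (λ x≢y x≡j y≡j → same x≢y (trans x≡j (sym y≡j)))

  module _ {m : ℕ} (occupied : ∀ {j} → j < m → ∃ λ x → x ∈ xs × level x ≡ j) where

    layer-occupant : ∀ {j} → j < m → ∃ λ x → x ∈ layer j
    layer-occupant j<m = let (x , x∈ , x≡j) = occupied j<m in x , ∈-layer⁺ x∈ x≡j

    layer-nonempty : ∀ {j} → j < m → layer j ≢ []
    layer-nonempty j<m = ∈⇒≢[] (proj₂ (layer-occupant j<m))

    last-layersBelow : ∀ j → j < m → last (layersBelow (suc j)) ≡ last (layer j)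
    last-layersBelow j j<m = last-++ (layersBelow j) (layer-nonempty j<m)

    head-layersBelow : ∀ j → j < m → head (layersBelow (suc j)) ≡ head (layer 0)
    head-layersBelow zero    _      = refl
    head-layersBelow (suc j) 1+j<m =
      trans (head-++ (∈⇒≢[] (∈-++⁺ʳ (layersBelow j) (proj₂ (layer-occupant j<m)))))
            (head-layersBelow j j<m)
      where
        j<m : j < m
        j<m = <⇒≤ 1+j<m

    length-layersBelow : ∀ j → j ≤ m → j ≤ length (layersBelow j)
    length-layersBelow zero    _     = z≤n
    length-layersBelow (suc j) j<m = begin
      suc j                                        ≡⟨ +-comm 1 j ⟩
      j + 1                                        ≤⟨ +-mono-≤ (length-layersBelow j (<⇒≤ j<m))
                                                               (∈-length (proj₂ (layer-occupant j<m))) ⟩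
      length (layersBelow j) + length (layer j)    ≡⟨ length-++ (layersBelow j) ⟨
      length (layersBelow (suc j))                 ∎
      where open ≤-Reasoning

    layersBelow-linked : ∀ {R : A → A → Set} → Unique xs →
                         (∀ {x y} → x ≢ y → level x ≡ level y → R x y) →
                         (∀ {x y} → suc (level x) ≡ level y → R x y) →
                         ∀ j → j ≤ m → Linked R (layersBelow j)
    layersBelow-linked unique same next zero          _       = []
    layersBelow-linked unique same next (suc zero)    _       = layer-linked unique same 0
    layersBelow-linked {R} unique same next (suc (suc j)) 1+j<m =
      ++⁺ (layersBelow-linked unique same next (suc j) (<⇒≤ 1+j<m)) boundary (layer-linked unique same (suc j))
      where
        boundary : Connected R (last (layersBelow (suc j))) (head (layer (suc j)))
        boundary = subst (λ l → Connected R l (head (layer (suc j)))) (sym (last-layersBelow j (<⇒≤ 1+j<m)))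
                     (All⇒Connected (layer-level j) (layer-level (suc j))
                        (λ x≡j y≡1+j → next (trans (cong suc x≡j) (sym y≡1+j))))

toℕ-successor : ∀ {k} {a b : Fin (suc k)} → suc (toℕ a) ≡ toℕ b → ∃ λ (i : Fin k) → a ≡ inject₁ i × b ≡ suc i
toℕ-successor {b = suc i} 1+a≡1+i = i , toℕ-injective (trans (cong pred 1+a≡1+i) (sym (toℕ-inject₁ i))) , refl

hamiltonian-blowUp : ∀ {A : Set} {Adj : A → A → Set} (xs : List A) → Unique xs → (∀ x → x ∈ xs) →
                     ∀ k → 2 ≤ k → (c : A → Fin (suc k)) → (∀ i → ∃ λ x → c x ≡ i) →
                     (∀ {x y} → x ≢ y → c x ≡ c y → Adj x y) →
                     (∀ {x y} (i : Fin k) → c x ≡ inject₁ i → c y ≡ suc i → Adj x y) →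
                     (∀ {x y} → c x ≡ fromℕ k → c y ≡ zero → Adj x y) →
                     Hamiltonian A _≡_ Adj
hamiltonian-blowUp {A} {Adj} xs unique complete k 2≤k c onto same next wrap =
  hamiltonian-fromList L (layersBelow-unique unique (suc k))
    (λ x → ∈-layersBelow⁺ (suc k) (complete x) (toℕ<n (c x)))
    (≤-trans (s≤s 2≤k) (length-layersBelow occupied (suc k) ≤-refl))
    (layersBelow-linked occupied unique same-level next-level (suc k) ≤-refl)
    closing
  where
    open Layers xs (toℕ ∘ c)

    L : List A
    L = layersBelow (suc k)

    occupied : ∀ {j} → j < suc k → ∃ λ x → x ∈ xs × toℕ (c x) ≡ j
    occupied j<1+k = let (x , cx≡j) = onto (fromℕ< j<1+k) in
      x , complete x , trans (cong toℕ cx≡j) (toℕ-fromℕ< j<1+k)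

    same-level : ∀ {x y} → x ≢ y → toℕ (c x) ≡ toℕ (c y) → Adj x y
    same-level x≢y cx≡cy = same x≢y (toℕ-injective cx≡cy)

    next-level : ∀ {x y} → suc (toℕ (c x)) ≡ toℕ (c y) → Adj x y
    next-level 1+cx≡cy = let (i , cx≡i , cy≡1+i) = toℕ-successor 1+cx≡cy in next i cx≡i cy≡1+i

    closing : Connected Adj (last L) (head L)
    closing = subst₂ (Connected Adj)
      (sym (last-layersBelow occupied k (n<1+n k))) (sym (head-layersBelow occupied k (n<1+n k)))
      (All⇒Connected (layer-level k) (layer-level 0)
        (λ cx≡k cy≡0 → wrap (toℕ-injective (trans cx≡k (sym (toℕ-fromℕ k)))) (toℕ-injective cy≡0)))

module _ (G : FiniteGroup) where

  CycLe-trans : ∀ {x y z} → CycLe G x y → CycLe G y z → CycLe G x z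
  CycLe-trans x≤y y≤z w w∈⟨x⟩ = y≤z w (x≤y w w∈⟨x⟩)

  ∼-sym : ∀ {x y} → _∼_ G x y → _∼_ G y x
  ∼-sym (x≤y , y≤x) = y≤x , x≤y

  ∼-trans : ∀ {x y z} → _∼_ G x y → _∼_ G y z → _∼_ G x z
  ∼-trans (x≤y , y≤x) (y≤z , z≤y) = CycLe-trans x≤y y≤z , CycLe-trans z≤y y≤x

  CycLe-resp-∼ : ∀ {x y a b} → _∼_ G x a → _∼_ G y b → CycLe G a b → CycLe G x y
  CycLe-resp-∼ (x≤a , _) (_ , b≤y) a≤b = CycLe-trans x≤a (CycLe-trans a≤b b≤y)

  ∼⇒PowAdj : ∀ {x y} → x ≢ y → _∼_ G x y → PowAdj G x y
  ∼⇒PowAdj x≢y (x≤y , _) = x≢y , inj₁ x≤y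

  CAdj⇒PowAdj : ∀ {x y a b} → _∼_ G x a → _∼_ G y b → CAdj G a b → PowAdj G x y
  CAdj⇒PowAdj {x} {y} x∼a y∼b (a≁b , a′ , b′ , a′∼a , b′∼b , a′⊂b′∨b′⊂a′) = x≢y , comparable a′⊂b′∨b′⊂a′
    where
      x∼a′ : _∼_ G x a′
      x∼a′ = ∼-trans x∼a (∼-sym a′∼a)
      y∼b′ : _∼_ G y b′
      y∼b′ = ∼-trans y∼b (∼-sym b′∼b)
      x≢y : x ≢ y
      x≢y refl = a≁b (∼-trans (∼-sym x∼a) y∼b)
      comparable : CycLt G b′ a′ ⊎ CycLt G a′ b′ → CycLe G x y ⊎ CycLe G y x
      comparable (inj₁ (b′≤a′ , _)) = inj₂ (CycLe-resp-∼ y∼b′ x∼a′ b′≤a′)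
      comparable (inj₂ (a′≤b′ , _)) = inj₁ (CycLe-resp-∼ x∼a′ y∼b′ a′≤b′)

proposition18 : (G : FiniteGroup) → CyclicSubgroupGraphHamiltonian G → PowerGraphHamiltonian G
proposition18 G (k , 2≤k , v , covers , distinct , adjacent , closes) =
  hamiltonian-blowUp (allFin n) (Unique.allFin⁺ n) ∈-allFin k 2≤k c onto same next wrap
  where
    open FiniteGroup G using (n)

    c : Elt G → Fin (suc k)
    c x = proj₁ (covers x)

    ∼-v : ∀ {x i} → c x ≡ i → _∼_ G x (v i)
    ∼-v {x} refl = proj₂ (covers x)

    onto : ∀ i → ∃ λ x → c x ≡ i
    onto i = v i , sym (distinct i (c (v i)) (∼-v refl))

    same : ∀ {x y} → x ≢ y → c x ≡ c y → PowAdj G x y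
    same x≢y cx≡cy = ∼⇒PowAdj G x≢y (∼-trans G (∼-v cx≡cy) (∼-sym G (∼-v refl)))

    next : ∀ {x y} (i : Fin k) → c x ≡ inject₁ i → c y ≡ suc i → PowAdj G x y
    next i cx≡i cy≡1+i = CAdj⇒PowAdj G (∼-v cx≡i) (∼-v cy≡1+i) (adjacent i)

    wrap : ∀ {x y} → c x ≡ fromℕ k → c y ≡ zero → PowAdj G x y
    wrap cx≡k cy≡0 = CAdj⇒PowAdj G (∼-v cx≡k) (∼-v cy≡0) closes
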